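{- Let $G$ be a 2-connected series-parallel graph with construction sequence $G_1,\dots,G_k$ as described in the context, and let $s,t\in V(G)$ be distinct non-adjacent vertices. If $\{s,t\}=V(G_1)$, then the minimum size of an $st$-separator of $G$ equals $\varepsilon(s,t)+1$; otherwise it equals $\varepsilon(s,t)+2$.
   Context: A construction sequence is a sequence of multigraphs $G_1,\dots,G_k$ where $G_1$ is a single edge on two vertices and each $G_{i+1}$ is obtained from $G_i$ by applying to some edge $e_i$ of $G_i$ either the series operation S (subdivide $e_i$ by a new vertex) or the parallel operation P (replace $e_i=xy$ by two parallel $xy$-edges), the first operation being P; $G$ is the simple graph obtained from $G_k$ by keeping one edge of each set of parallel edges. $\varepsilon(s,t)$ is the number of indices $i$ for which the operation applied to $e_i$ is P and $e_i$ has endpoints $s$ and $t$ ($0$ if no $G_i$ contains an $st$-edge). An $st$-separator is $S\subseteq V(G)\setminus\{s,t\}$ with $s,t$ in different components of $G-S$. -}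

module Defs where

open import Data.Nat using (ℕ; zero; suc; _≤_)
open import Data.Nat.Properties using (_≟_)
open import Data.Fin using (Fin; toℕ)
open import Data.Fin.Subset using (Subset; _∉_; ∣_∣; ⁅_⁆)
import Data.Fin.Subset
open import Data.List using (List; []; _∷_; length; lookup; removeAt; _∷ʳ_)
open import Data.List.Membership.Propositional using (_∈_)
open import Data.Product using (_×_; _,_; ∃)
open import Data.Sum using (_⊎_)
open import Data.Unit using (⊤)
open import Data.Bool using (Bool; true; false)
open import Relation.Nullary using (¬_; yes; no)
open import Relation.Binary.PropositionalEquality using (_≡_; _≢_)

-- A multigraph: vertices are the naturals 0 .. nv-1, edges a list
-- (so parallel edges are repeated entries) of ordered pairs of endpoints.
record MG : Set where
  constructor mg
  field
    nv    : ℕ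
    edges : List (ℕ × ℕ)
open MG public

G₁ : MG
G₁ = mg 2 ((0 , 1) ∷ [])

data Op : Set where
  S P : Op

apply : Op → (G : MG) → Fin (length (edges G)) → MG
apply S (mg n es) i with lookup es i
... | (x , y) = mg (suc n) ((x , n) ∷ (n , y) ∷ removeAt es i)
apply P (mg n es) i = mg n (lookup es i ∷ es)

-- ConstrSeq G log : G = G_k is the last multigraph of a sequence
-- G₁, …, G_k obtained by the operations; log records, in order, each
-- operation together with the endpoints of the edge e_i it was applied to.
data ConstrSeq : MG → List (Op × (ℕ × ℕ)) → Set where
  start : ConstrSeq G₁ []
  step  : ∀ {G log} → ConstrSeq G log → (o : Op) → (i : Fin (length (edges G))) →
          ConstrSeq (apply o G i) (log ∷ʳ (o , lookup (edges G) i))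

FirstIsP : List (Op × (ℕ × ℕ)) → Set
FirstIsP []              = ⊤
FirstIsP ((o , _) ∷ _)   = o ≡ P

endpointsAre : ℕ → ℕ → ℕ × ℕ → Bool
endpointsAre s t (x , y) with x ≟ s | y ≟ t | x ≟ t | y ≟ s
... | yes _ | yes _ | _     | _     = true
... | _     | _     | yes _ | yes _ = true
... | _     | _     | _     | _     = false

ε : List (Op × (ℕ × ℕ)) → ℕ → ℕ → ℕ
ε []                  s t = 0
ε ((S , e) ∷ log)     s t = ε log s t
ε ((P , e) ∷ log)     s t with endpointsAre s t e
... | true  = suc (ε log s t)
... | false = ε log s t

-- The simple graph G underlying a multigraph (one edge kept per parallel
-- class); vertices are Fin (nv G).
module _ (G : MG) where
  V : Set
  V = Fin (nv G)

  Adj : V → V → Set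
  Adj u v = ((toℕ u , toℕ v) ∈ edges G) ⊎ ((toℕ v , toℕ u) ∈ edges G)

  data Reach (X : Subset (nv G)) : V → V → Set where
    here  : ∀ {u} → u ∉ X → Reach X u u
    there : ∀ {u v w} → u ∉ X → Adj u v → Reach X v w → Reach X u w

  Connected-without : Subset (nv G) → Set
  Connected-without X = ∀ u v → u ∉ X → v ∉ X → Reach X u v

  TwoConnected : Set
  TwoConnected = (3 ≤ nv G) × Connected-without Data.Fin.Subset.⊥ × (∀ x → Connected-without ⁅ x ⁆)

  IsSeparator : V → V → Subset (nv G) → Set
  IsSeparator s t X = s ∉ X × t ∉ X × ¬ Reach X s t

  MinSepSize : V → V → ℕ → Set
  MinSepSize s t m = (∃ λ X → IsSeparator s t X × ∣ X ∣ ≡ m)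
                   × (∀ X → IsSeparator s t X → m ≤ ∣ X ∣)

module Submission where

-- View the construction as a sequence of multigraphs with
-- vertices 0 … N-1.  For distinct vertices s, t call X (avoiding s, t) an
-- s–t cut if no s–t walk survives deleting X together with all st-edges; its
-- cost is |X| plus the number of st-edges, and the minimum cost is the local
-- connectivity of s and t.  By induction along the construction sequence we
-- show that after the first operation (which doubles the edge 01) it equals
-- κ(s,t) = ε(s,t) + 1 if {s,t} = {0,1} and ε(s,t) + 2 otherwise.  A P-operation on e adds one to both sides exactly
-- when e is an st-edge.  An S-operation subdividing xy by a new vertex n keeps
-- the value for old pairs (n replaces the edge xy in a cut, or is contracted
-- into x or y), and gives κ(n,t) = 2: the neighbours of n other than t form a
-- cut, and every cut costs at least 2 because κ ≥ 2 for old pairs.  For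
-- nonadjacent s, t there are no st-edges, and minimum cuts of G_k are exactly
-- minimum st-separators of the simple graph G; 2-connectivity only excludes
-- G = G₁.

open import Defs
open import Data.Nat using (ℕ; zero; suc; _+_; _≤_; _<_; z≤n; s≤s; _≡ᵇ_)
open import Data.Nat.Properties
open import Data.Fin using (Fin; toℕ; fromℕ<) renaming (zero to fzero; suc to fsuc)
open import Data.List using (List; []; _∷_; length; lookup; removeAt; _∷ʳ_)
open import Data.List.Membership.Propositional using (_∈_)
open import Data.List.Relation.Unary.Any using (here; there)
open import Data.List.Membership.Propositional.Properties using (∈-lookup; ∈-++⁻)
open import Data.Fin.Properties using (toℕ<n; toℕ-fromℕ<; toℕ-injective)
open import Data.Fin.Subset using (Subset; _∉_; ∣_∣)
import Data.Vec as Vec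
open import Data.Vec using ([]; _∷_)
open import Data.Vec.Properties using (lookup⇒[]=; []=⇒lookup; lookup∘tabulate)
open import Data.Product using (_×_; _,_; proj₁; proj₂; ∃)
open import Data.Sum using (_⊎_; inj₁; inj₂)
open import Data.Bool using (Bool; true; false; _∨_; _∧_; not; if_then_else_; T)
open import Data.Bool.Properties using (∨-conicalʳ; ∨-zeroʳ; ¬-not)
open import Data.Unit using (tt)
open import Data.Empty using (⊥; ⊥-elim)
open import Function using (_∘_)
open import Relation.Nullary using (¬_; Dec; yes; no; _because_; contradiction)
open import Relation.Nullary.Reflects using (Reflects; ofʸ; ofⁿ; det)
open import Relation.Binary.PropositionalEquality
open import Algebra.Properties.CommutativeSemigroup +-commutativeSemigroup using (x∙yz≈y∙xz; x∙yz≈xz∙y; xy∙z≈xz∙y)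

Joins : ℕ → ℕ → ℕ × ℕ → Set
Joins a b (u , v) = (u ≡ a × v ≡ b) ⊎ (u ≡ b × v ≡ a)

endpointsAre-reflects : ∀ a b e → Reflects (Joins a b e) (endpointsAre a b e)
endpointsAre-reflects a b (u , v) with u ≟ a | v ≟ b | u ≟ b | v ≟ a
... | yes p  | yes q  | _      | _      = ofʸ (inj₁ (p , q))
... | no _   | _      | yes p  | yes q  = ofʸ (inj₂ (p , q))
... | yes _  | no _   | yes p  | yes q  = ofʸ (inj₂ (p , q))
... | no ¬p  | _      | yes _  | no ¬q  = ofⁿ λ { (inj₁ (p , _)) → ¬p p ; (inj₂ (_ , q)) → ¬q q }
... | no ¬p  | _      | no ¬p′ | _      = ofⁿ λ { (inj₁ (p , _)) → ¬p p ; (inj₂ (p , _)) → ¬p′ p }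
... | yes _  | no ¬q  | yes _  | no ¬q′ = ofⁿ λ { (inj₁ (_ , q)) → ¬q q ; (inj₂ (_ , q)) → ¬q′ q }
... | yes _  | no ¬q  | no ¬p′ | _      = ofⁿ λ { (inj₁ (_ , q)) → ¬q q ; (inj₂ (p , _)) → ¬p′ p }

joins? : ∀ a b e → Dec (Joins a b e)
joins? a b e = endpointsAre a b e because endpointsAre-reflects a b e

endpointsAre-true : ∀ {a b e} → Joins a b e → endpointsAre a b e ≡ true
endpointsAre-true {a} {b} {e} j = det (endpointsAre-reflects a b e) (ofʸ j)

endpointsAre-false : ∀ {a b e} → ¬ Joins a b e → endpointsAre a b e ≡ false
endpointsAre-false {a} {b} {e} ¬j = det (endpointsAre-reflects a b e) (ofⁿ ¬j)

Joins-flip : ∀ {a b u v} → Joins a b (u , v) → Joins a b (v , u)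
Joins-flip (inj₁ (p , q)) = inj₂ (q , p)
Joins-flip (inj₂ (p , q)) = inj₁ (q , p)

Joins-swap : ∀ {a b e} → Joins a b e → Joins b a e
Joins-swap (inj₁ pq) = inj₂ pq
Joins-swap (inj₂ pq) = inj₁ pq

reflects-⇔ : ∀ {A B : Set} {b} → (A → B) → (B → A) → Reflects A b → Reflects B b
reflects-⇔ f g (ofʸ a)  = ofʸ (f a)
reflects-⇔ f g (ofⁿ ¬a) = ofⁿ (¬a ∘ g)

endpointsAre-swap : ∀ a b e → endpointsAre a b e ≡ endpointsAre b a e
endpointsAre-swap a b e =
  det (endpointsAre-reflects a b e) (reflects-⇔ Joins-swap Joins-swap (endpointsAre-reflects b a e))

indicator : Bool → ℕ
indicator true  = 1
indicator false = 0

ε-P : ∀ e log s t → ε ((P , e) ∷ log) s t ≡ indicator (endpointsAre s t e) + ε log s t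
ε-P e log s t with endpointsAre s t e
... | true  = refl
... | false = refl

ε-sym : ∀ log s t → ε log s t ≡ ε log t s
ε-sym []              s t = refl
ε-sym ((S , e) ∷ log) s t = ε-sym log s t
ε-sym ((P , e) ∷ log) s t = begin
  ε ((P , e) ∷ log) s t                            ≡⟨ ε-P e log s t ⟩
  indicator (endpointsAre s t e) + ε log s t       ≡⟨ cong₂ _+_ (cong indicator (endpointsAre-swap s t e)) (ε-sym log s t) ⟩
  indicator (endpointsAre t s e) + ε log t s       ≡⟨ ε-P e log t s ⟨
  ε ((P , e) ∷ log) t s                            ∎
  where open ≡-Reasoning

ε-snoc : ∀ log o e s t → ε (log ∷ʳ (o , e)) s t ≡ ε log s t + ε ((o , e) ∷ []) s t
ε-snoc []              o e s t = refl
ε-snoc ((S , e′) ∷ log) o e s t = ε-snoc log o e s t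
ε-snoc ((P , e′) ∷ log) o e s t with endpointsAre s t e′
... | true  = cong suc (ε-snoc log o e s t)
... | false = ε-snoc log o e s t

ε-snoc-S : ∀ log e s t → ε (log ∷ʳ (S , e)) s t ≡ ε log s t
ε-snoc-S log e s t = trans (ε-snoc log S e s t) (+-identityʳ _)

ε-snoc-P : ∀ log e s t → ε (log ∷ʳ (P , e)) s t ≡ ε log s t + indicator (endpointsAre s t e)
ε-snoc-P log e s t = trans (ε-snoc log P e s t) (cong (ε log s t +_) (trans (ε-P e [] s t) (+-identityʳ _)))

ε-snoc-≤ : ∀ log a s t → ε log s t ≤ ε (log ∷ʳ a) s t
ε-snoc-≤ log (o , e) s t = subst (ε log s t ≤_) (sym (ε-snoc log o e s t)) (m≤m+n _ _)

ε-unused : ∀ log n t → (∀ {o e} → (o , e) ∈ log → ¬ Joins n t e) → ε log n t ≡ 0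
ε-unused []              n t unused = refl
ε-unused ((S , e) ∷ log) n t unused = ε-unused log n t (unused ∘ there)
ε-unused ((P , e) ∷ log) n t unused = begin
  ε ((P , e) ∷ log) n t                       ≡⟨ ε-P e log n t ⟩
  indicator (endpointsAre n t e) + ε log n t  ≡⟨ cong₂ _+_ (cong indicator (endpointsAre-false (unused (here refl))))
                                                          (ε-unused log n t (unused ∘ there)) ⟩
  0                                           ∎
  where open ≡-Reasoning

multiplicity : List (ℕ × ℕ) → ℕ → ℕ → ℕ
multiplicity []      s t = 0
multiplicity (e ∷ E) s t = indicator (endpointsAre s t e) + multiplicity E s t

multiplicity-sym : ∀ E s t → multiplicity E s t ≡ multiplicity E t s
multiplicity-sym []      s t = refl
multiplicity-sym (e ∷ E) s t = cong₂ _+_ (cong indicator (endpointsAre-swap s t e)) (multiplicity-sym E s t)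

multiplicity-removeAt : ∀ E i s t →
  multiplicity E s t ≡ indicator (endpointsAre s t (lookup E i)) + multiplicity (removeAt E i) s t
multiplicity-removeAt (e ∷ E) fzero    s t = refl
multiplicity-removeAt (e ∷ E) (fsuc i) s t =
  trans (cong (indicator (endpointsAre s t e) +_) (multiplicity-removeAt E i s t))
        (x∙yz≈y∙xz (indicator (endpointsAre s t e)) (indicator (endpointsAre s t (lookup E i)))
                   (multiplicity (removeAt E i) s t))

multiplicity-zero : ∀ E s t → (∀ {e} → e ∈ E → ¬ Joins s t e) → multiplicity E s t ≡ 0
multiplicity-zero []      s t none = refl
multiplicity-zero (e ∷ E) s t none
  rewrite endpointsAre-false (none (here refl)) = multiplicity-zero E s t (none ∘ there)

-- Finite vertex sets are boolean predicates on ℕ; count N X is |X ∩ {0, …, N-1}|.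
VSet : Set
VSet = ℕ → Bool

count : ℕ → VSet → ℕ
count zero    X = 0
count (suc N) X = indicator (X 0) + count N (X ∘ suc)

⁅_⁆ᵛ : ℕ → VSet
⁅ z ⁆ᵛ v = v ≡ᵇ z

insert : ℕ → VSet → VSet
insert z X v = (v ≡ᵇ z) ∨ X v

delete : ℕ → VSet → VSet
delete z X v = not (v ≡ᵇ z) ∧ X v

≡ᵇ-refl : ∀ n → (n ≡ᵇ n) ≡ true
≡ᵇ-refl zero    = refl
≡ᵇ-refl (suc n) = ≡ᵇ-refl n

≢⇒≡ᵇ-false : ∀ {m n} → m ≢ n → (m ≡ᵇ n) ≡ false
≢⇒≡ᵇ-false {zero}  {zero}  m≢n = contradiction refl m≢n
≢⇒≡ᵇ-false {zero}  {suc n} m≢n = refl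
≢⇒≡ᵇ-false {suc m} {zero}  m≢n = refl
≢⇒≡ᵇ-false {suc m} {suc n} m≢n = ≢⇒≡ᵇ-false (m≢n ∘ cong suc)

count-ext : ∀ N X Y → (∀ v → v < N → X v ≡ Y v) → count N X ≡ count N Y
count-ext zero    X Y same = refl
count-ext (suc N) X Y same =
  cong₂ _+_ (cong indicator (same 0 (s≤s z≤n))) (count-ext N _ _ (λ v v<N → same (suc v) (s≤s v<N)))

count-mono : ∀ N X Y → (∀ v → v < N → X v ≡ true → Y v ≡ true) → count N X ≤ count N Y
count-mono zero    X Y X⊆Y = z≤n
count-mono (suc N) X Y X⊆Y = +-mono-≤ (indicator-mono (X⊆Y 0 (s≤s z≤n)))
                                      (count-mono N _ _ (λ v v<N → X⊆Y (suc v) (s≤s v<N)))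
  where
    indicator-mono : ∀ {a b} → (a ≡ true → b ≡ true) → indicator a ≤ indicator b
    indicator-mono {false} imp = z≤n
    indicator-mono {true}  imp rewrite imp refl = ≤-refl

count-suc : ∀ N X → count (suc N) X ≡ count N X + indicator (X N)
count-suc zero    X = +-comm (indicator (X 0)) 0
count-suc (suc N) X = trans (cong (indicator (X 0) +_) (count-suc N (X ∘ suc)))
                            (sym (+-assoc (indicator (X 0)) _ _))

count-∅ : ∀ N → count N (λ _ → false) ≡ 0
count-∅ zero    = refl
count-∅ (suc N) = count-∅ N

count-update-≤ : ∀ N X Y z → (∀ v → v ≢ z → Y v ≡ X v) → count N Y ≤ count N X + 1
count-update-≤ zero    X Y z same = z≤n
count-update-≤ (suc N) X Y zero same
  rewrite count-ext N (Y ∘ suc) (X ∘ suc) (λ v _ → same (suc v) λ ()) = bound (Y 0) (X 0) (count N (X ∘ suc))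
  where
    bound : ∀ y x c → indicator y + c ≤ indicator x + c + 1
    bound true  x c rewrite +-comm (indicator x + c) 1 = s≤s (m≤n+m c (indicator x))
    bound false x c = ≤-trans (m≤n+m c (indicator x)) (m≤m+n (indicator x + c) 1)
count-update-≤ (suc N) X Y (suc z) same
  rewrite same 0 (λ ()) | +-assoc (indicator (X 0)) (count N (X ∘ suc)) 1 =
  +-monoʳ-≤ (indicator (X 0)) (count-update-≤ N (X ∘ suc) (Y ∘ suc) z (λ v v≢z → same (suc v) (v≢z ∘ suc-injective)))

count-add : ∀ N X Y z → z < N → X z ≡ false → Y z ≡ true → (∀ v → v ≢ z → Y v ≡ X v) →
            count N Y ≡ suc (count N X)
count-add (suc N) X Y zero z<N Xz Yz same rewrite Xz | Yz =
  cong suc (count-ext N (Y ∘ suc) (X ∘ suc) (λ v _ → same (suc v) λ ()))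
count-add (suc N) X Y (suc z) (s≤s z<N) Xz Yz same rewrite same 0 (λ ()) =
  trans (cong (indicator (X 0) +_)
              (count-add N (X ∘ suc) (Y ∘ suc) z z<N Xz Yz (λ v v≢z → same (suc v) (v≢z ∘ suc-injective))))
        (+-suc (indicator (X 0)) _)

count-singleton : ∀ N z → z < N → count N ⁅ z ⁆ᵛ ≡ 1
count-singleton N z z<N =
  trans (count-add N (λ _ → false) ⁅ z ⁆ᵛ z z<N refl (≡ᵇ-refl z) (λ v → ≢⇒≡ᵇ-false)) (cong suc (count-∅ N))

count-pair : ∀ N x y → x < N → y < N → x ≢ y → count N (insert y ⁅ x ⁆ᵛ) ≡ 2
count-pair N x y x<N y<N x≢y =
  trans (count-add N ⁅ x ⁆ᵛ (insert y ⁅ x ⁆ᵛ) y y<N (≢⇒≡ᵇ-false (x≢y ∘ sym)) (cong (_∨ (y ≡ᵇ x)) (≡ᵇ-refl y))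
                   (λ v v≢y → cong (_∨ (v ≡ᵇ x)) (≢⇒≡ᵇ-false v≢y)))
        (cong suc (count-singleton N x x<N))

count-≤-suc : ∀ N X → count N X ≤ count (suc N) X
count-≤-suc N X = subst (count N X ≤_) (sym (count-suc N X)) (m≤m+n (count N X) _)

≡ᵇ-true⇒≡ : ∀ {m n} → (m ≡ᵇ n) ≡ true → m ≡ n
≡ᵇ-true⇒≡ {m} {n} eq = ≡ᵇ⇒≡ m n (subst T (sym eq) tt)

count-≥-singleton : ∀ N X z → z < N → X z ≡ true → 1 ≤ count N X
count-≥-singleton N X z z<N Xz = subst (_≤ count N X) (count-singleton N z z<N)
  (count-mono N ⁅ z ⁆ᵛ X λ v _ v≡z → subst (λ w → X w ≡ true) (sym (≡ᵇ-true⇒≡ v≡z)) Xz)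

count-≥-pair : ∀ N X x y → x < N → y < N → x ≢ y → X x ≡ true → X y ≡ true → 2 ≤ count N X
count-≥-pair N X x y x<N y<N x≢y Xx Xy = subst (_≤ count N X) (count-pair N x y x<N y<N x≢y)
  (count-mono N (insert y ⁅ x ⁆ᵛ) X member)
  where
    member : ∀ v → v < N → insert y ⁅ x ⁆ᵛ v ≡ true → X v ≡ true
    member v _ v∈ with v ≡ᵇ y in v≡ᵇy
    ... | true  = subst (λ w → X w ≡ true) (sym (≡ᵇ-true⇒≡ v≡ᵇy)) Xy
    ... | false = subst (λ w → X w ≡ true) (sym (≡ᵇ-true⇒≡ v∈)) Xx

∈-removeAt⁻ : ∀ {A : Set} (E : List A) i {e} → e ∈ removeAt E i → e ∈ E
∈-removeAt⁻ (x ∷ E) fzero    m         = there m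
∈-removeAt⁻ (x ∷ E) (fsuc i) (here p)  = here p
∈-removeAt⁻ (x ∷ E) (fsuc i) (there m) = there (∈-removeAt⁻ E i m)

∈-removeAt-split : ∀ {A : Set} (E : List A) i {e} → e ∈ E → e ∈ removeAt E i ⊎ e ≡ lookup E i
∈-removeAt-split (x ∷ E) fzero    (here p)  = inj₂ p
∈-removeAt-split (x ∷ E) fzero    (there m) = inj₁ m
∈-removeAt-split (x ∷ E) (fsuc i) (here p)  = inj₁ (here p)
∈-removeAt-split (x ∷ E) (fsuc i) (there m) with ∈-removeAt-split E i m
... | inj₁ m′ = inj₁ (there m′)
... | inj₂ q  = inj₂ q

-- Walks in a multigraph (given by its edge list E) that avoid a vertex set X
-- and never use an a–b edge: these are the walks of "G − X minus the ab-edges".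

Step : List (ℕ × ℕ) → ℕ → ℕ → ℕ → ℕ → Set
Step E a b u v = ((u , v) ∈ E ⊎ (v , u) ∈ E) × ¬ Joins a b (u , v)

data Walk (E : List (ℕ × ℕ)) (X : VSet) (a b : ℕ) : ℕ → ℕ → Set where
  nil  : ∀ {u} → X u ≡ false → Walk E X a b u u
  cons : ∀ {u v w} → X u ≡ false → Step E a b u v → Walk E X a b v w → Walk E X a b u w

module _ {E : List (ℕ × ℕ)} {X : VSet} {a b : ℕ} where

  start-free : ∀ {u w} → Walk E X a b u w → X u ≡ false
  start-free (nil Xu)      = Xu
  start-free (cons Xu _ _) = Xu

  end-free : ∀ {u w} → Walk E X a b u w → X w ≡ false
  end-free (nil Xw)     = Xw
  end-free (cons _ _ p) = end-free p

  _++ʷ_ : ∀ {u v w} → Walk E X a b u v → Walk E X a b v w → Walk E X a b u w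
  nil _        ++ʷ q = q
  cons Xu st p ++ʷ q = cons Xu st (p ++ʷ q)

  edge : ∀ {u v} → X u ≡ false → X v ≡ false → Step E a b u v → Walk E X a b u v
  edge Xu Xv st = cons Xu st (nil Xv)

  reverse-step : ∀ {u v} → Step E a b u v → Step E a b v u
  reverse-step (inj₁ m , ¬j) = inj₂ m , ¬j ∘ Joins-flip
  reverse-step (inj₂ m , ¬j) = inj₁ m , ¬j ∘ Joins-flip

  reverse : ∀ {u w} → Walk E X a b u w → Walk E X a b w u
  reverse (nil Xu)      = nil Xu
  reverse (cons Xu st p) = reverse p ++ʷ edge (start-free p) Xu (reverse-step st)

walk-map : ∀ {E E′ X X′ a b a′ b′} (π : ℕ → ℕ) →
  (∀ {u v} → (u , v) ∈ E → X u ≡ false → X v ≡ false → ¬ Joins a b (u , v) → Walk E′ X′ a′ b′ (π u) (π v)) →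
  ∀ {u w} → X′ (π w) ≡ false → Walk E X a b u w → Walk E′ X′ a′ b′ (π u) (π w)
walk-map π image Xw (nil _) = nil Xw
walk-map π image Xw (cons Xu (inj₁ m , ¬j) p) = image m Xu (start-free p) ¬j ++ʷ walk-map π image Xw p
walk-map π image Xw (cons Xu (inj₂ m , ¬j) p) =
  reverse (image m (start-free p) Xu (¬j ∘ Joins-flip)) ++ʷ walk-map π image Xw p

walk-edges : ∀ {E E′ X a b u w} → (∀ {e} → e ∈ E → e ∈ E′) → Walk E X a b u w → Walk E′ X a b u w
walk-edges E⊆E′ p = walk-map (λ v → v) (λ m Xu Xv ¬j → edge Xu Xv (inj₁ (E⊆E′ m) , ¬j)) (end-free p) p

walk-swap : ∀ {E X a b u w} → Walk E X a b u w → Walk E X b a u w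
walk-swap (nil Xu)              = nil Xu
walk-swap (cons Xu (m , ¬j) p) = cons Xu (m , ¬j ∘ Joins-swap) (walk-swap p)

EdgesIn : ℕ → List (ℕ × ℕ) → Set
EdgesIn N E = ∀ {u v} → (u , v) ∈ E → u < N × v < N × u ≢ v

-- A walk in such a multigraph only sees vertices below N, so only the part
-- of the avoided set below N matters.
walk-restrict : ∀ {N E X Y a b u w} → EdgesIn N E → u < N → (∀ v → v < N → X v ≡ false → Y v ≡ false) →
                Walk E X a b u w → Walk E Y a b u w
walk-restrict {u = u} inN u<N X⊇Y (nil Xu)     = nil (X⊇Y u u<N Xu)
walk-restrict {u = u} inN u<N X⊇Y (cons Xu st p) = cons (X⊇Y u u<N Xu) st (walk-restrict inN (next st) X⊇Y p)
  where
    next : ∀ {v} → Step _ _ _ u v → v < _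
    next (inj₁ m , _) = proj₁ (proj₂ (inN m))
    next (inj₂ m , _) = proj₁ (inN m)

-- Cuts and local connectivity in a multigraph on the vertices 0 … N-1.

Cut : List (ℕ × ℕ) → VSet → ℕ → ℕ → Set
Cut E X s t = X s ≡ false × X t ≡ false × ¬ Walk E X s t s t

-- The cost of a cut counts its vertices and the st-edges deleted along with it.
cost : ℕ → List (ℕ × ℕ) → VSet → ℕ → ℕ → ℕ
cost N E X s t = count N X + multiplicity E s t

MinCut : ℕ → List (ℕ × ℕ) → ℕ → ℕ → ℕ → Set
MinCut N E s t k = (∃ λ X → Cut E X s t × cost N E X s t ≡ k) × (∀ X → Cut E X s t → k ≤ cost N E X s t)

Cut-sym : ∀ {E X s t} → Cut E X s t → Cut E X t s
Cut-sym (Xs , Xt , noWalk) = Xt , Xs , noWalk ∘ walk-swap ∘ reverse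

MinCut-sym : ∀ {N E s t k} → MinCut N E s t k → MinCut N E t s k
MinCut-sym {N} {E} {s} {t} {k} ((X , cut , cost≡k) , minimal) =
  (X , Cut-sym cut , trans (cost-sym X) cost≡k) ,
  λ Y cut′ → subst (k ≤_) (sym (cost-sym Y)) (minimal Y (Cut-sym cut′))
  where
    cost-sym : ∀ X → cost N E X t s ≡ cost N E X s t
    cost-sym X = cong (count N X +_) (multiplicity-sym E t s)

offset : ℕ → ℕ → ℕ
offset zero       (suc zero) = 1
offset (suc zero) zero       = 1
offset _          _          = 2

κ : List (Op × (ℕ × ℕ)) → ℕ → ℕ → ℕ
κ log s t = ε log s t + offset s t

offset-sym : ∀ s t → offset s t ≡ offset t s
offset-sym zero             zero             = refl
offset-sym zero             (suc zero)       = refl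
offset-sym zero             (suc (suc t))    = refl
offset-sym (suc zero)       zero             = refl
offset-sym (suc zero)       (suc zero)       = refl
offset-sym (suc zero)       (suc (suc t))    = refl
offset-sym (suc (suc s))    zero             = refl
offset-sym (suc (suc s))    (suc zero)       = refl
offset-sym (suc (suc s))    (suc (suc t))    = refl

offset-far : ∀ {s} t → 2 ≤ s → offset s t ≡ 2
offset-far t (s≤s (s≤s _)) = refl

κ-sym : ∀ log s t → κ log s t ≡ κ log t s
κ-sym log s t = cong₂ _+_ (ε-sym log s t) (offset-sym s t)

BaseDoubled : List (Op × (ℕ × ℕ)) → Set
BaseDoubled log = 1 ≤ ε log 0 1

κ≥2 : ∀ log → BaseDoubled log → ∀ s t → s ≢ t → 2 ≤ κ log s t
κ≥2 log doubled zero          zero          s≢t = contradiction refl s≢t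
κ≥2 log doubled zero          (suc zero)    s≢t = +-monoˡ-≤ 1 doubled
κ≥2 log doubled (suc zero)    zero          s≢t = +-monoˡ-≤ 1 (subst (1 ≤_) (ε-sym log 0 1) doubled)
κ≥2 log doubled (suc zero)    (suc zero)    s≢t = contradiction refl s≢t
κ≥2 log doubled zero          (suc (suc t)) s≢t = m≤n+m 2 _
κ≥2 log doubled (suc zero)    (suc (suc t)) s≢t = m≤n+m 2 _
κ≥2 log doubled (suc (suc s)) t             s≢t = m≤n+m 2 _

Connectivity : MG → List (Op × (ℕ × ℕ)) → Set
Connectivity G log = ∀ s t → s < nv G → t < nv G → s ≢ t → MinCut (nv G) (edges G) s t (κ log s t)

CutsAtLeast2 : ℕ → List (ℕ × ℕ) → Set
CutsAtLeast2 N E = ∀ s t → s < N → t < N → s ≢ t → ∀ X → Cut E X s t → 2 ≤ cost N E X s t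

cuts-at-least-2 : ∀ {G log} → Connectivity G log → BaseDoubled log → CutsAtLeast2 (nv G) (edges G)
cuts-at-least-2 {log = log} conn doubled s t s<N t<N s≢t X cut =
  ≤-trans (κ≥2 log doubled s t s≢t) (proj₂ (conn s t s<N t<N s≢t) X cut)

G₂ : MG
G₂ = apply P G₁ fzero

connectivity-G₂ : Connectivity G₂ ((P , (0 , 1)) ∷ [])
connectivity-G₂ zero       (suc zero) _ _ _ =
  ((λ _ → false) , (refl , refl , 0≢1 ∘ stuck) , refl) , λ Y _ → m≤n+m 2 (count 2 Y)
  where
    0≢1 : 0 ≢ 1
    0≢1 ()
    -- every edge of G₂ is a 01-edge, so no walk avoiding them moves
    stuck : ∀ {X u w} → Walk (edges G₂) X 0 1 u w → u ≡ w
    stuck (nil _)                                = refl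
    stuck (cons _ (inj₁ (here refl) , ¬j) _)         = contradiction (inj₁ (refl , refl)) ¬j
    stuck (cons _ (inj₁ (there (here refl)) , ¬j) _) = contradiction (inj₁ (refl , refl)) ¬j
    stuck (cons _ (inj₂ (here refl) , ¬j) _)         = contradiction (inj₂ (refl , refl)) ¬j
    stuck (cons _ (inj₂ (there (here refl)) , ¬j) _) = contradiction (inj₂ (refl , refl)) ¬j
connectivity-G₂ (suc zero) zero       s<2 t<2 _   =
  MinCut-sym {N = 2} (connectivity-G₂ 0 1 t<2 s<2 (λ ()))
connectivity-G₂ zero       zero       _   _   s≢t = contradiction refl s≢t
connectivity-G₂ (suc zero) (suc zero) _   _   s≢t = contradiction refl s≢t
connectivity-G₂ (suc (suc s)) t       (s≤s (s≤s ())) _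
connectivity-G₂ s (suc (suc t))       _ (s≤s (s≤s ()))

-- A P-operation duplicates the edge e: the cuts are unchanged, while both the
-- cost of every s–t cut and κ(s,t) grow by one exactly when e is an st-edge.
parallel-step : ∀ n E log (i : Fin (length E)) → Connectivity (mg n E) log →
                Connectivity (mg n (lookup E i ∷ E)) (log ∷ʳ (P , lookup E i))
parallel-step n E log i conn s t s<n t<n s≢t with conn s t s<n t<n s≢t
... | ((X , (Xs , Xt , noWalk) , cost≡κ) , minimal) =
  (X , (Xs , Xt , noWalk ∘ walk-edges drop-copy) , trans (cost-grows X) (trans (cong (_+ δ) cost≡κ) (sym κ-grows))) ,
  λ Y (Ys , Yt , noWalk′) → subst₂ _≤_ (sym κ-grows) (sym (cost-grows Y))
                                    (+-monoˡ-≤ δ (minimal Y (Ys , Yt , noWalk′ ∘ walk-edges there)))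
  where
    e : ℕ × ℕ
    e = lookup E i
    δ : ℕ
    δ = indicator (endpointsAre s t e)
    drop-copy : ∀ {f} → f ∈ e ∷ E → f ∈ E
    drop-copy (here refl) = ∈-lookup i
    drop-copy (there m)   = m
    cost-grows : ∀ X → cost n (e ∷ E) X s t ≡ cost n E X s t + δ
    cost-grows X = x∙yz≈xz∙y (count n X) δ (multiplicity E s t)
    κ-grows : κ (log ∷ʳ (P , e)) s t ≡ κ log s t + δ
    κ-grows = trans (cong (_+ offset s t) (ε-snoc-P log e s t)) (xy∙z≈xz∙y (ε log s t) δ (offset s t))

LogIn : ℕ → List (Op × (ℕ × ℕ)) → Set
LogIn N log = ∀ {o u v} → (o , (u , v)) ∈ log → u < N × v < N

module Subdivision (n : ℕ) (E : List (ℕ × ℕ)) (i : Fin (length E)) (x y : ℕ)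
                   (eᵢ≡xy : lookup E i ≡ (x , y)) (inRange : EdgesIn n E) where

  R : List (ℕ × ℕ)
  R = removeAt E i

  E′ : List (ℕ × ℕ)
  E′ = (x , n) ∷ (n , y) ∷ R

  xy∈E : (x , y) ∈ E
  xy∈E = subst (_∈ E) eᵢ≡xy (∈-lookup i)

  x<n : x < n
  x<n = proj₁ (inRange xy∈E)

  y<n : y < n
  y<n = proj₁ (proj₂ (inRange xy∈E))

  x≢y : x ≢ y
  x≢y = proj₂ (proj₂ (inRange xy∈E))

  R-old : ∀ {u v} → (u , v) ∈ R → u < n × v < n
  R-old m = let u<n , v<n , _ = inRange (∈-removeAt⁻ E i m) in u<n , v<n

  fresh : ∀ {v} → v < n → v ≢ n
  fresh = <⇒≢

  ¬Joins-old-edge : ∀ {t u v} → u < n → v < n → ¬ Joins n t (u , v)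
  ¬Joins-old-edge u<n v<n (inj₁ (u≡n , _)) = fresh u<n u≡n
  ¬Joins-old-edge u<n v<n (inj₂ (_ , v≡n)) = fresh v<n v≡n

  ¬Joins-into-n : ∀ {a b u} → a < n → b < n → ¬ Joins a b (u , n)
  ¬Joins-into-n a<n b<n (inj₁ (_ , n≡b)) = fresh b<n (sym n≡b)
  ¬Joins-into-n a<n b<n (inj₂ (_ , n≡a)) = fresh a<n (sym n≡a)

  ¬Joins-out-of-n : ∀ {a b u} → a < n → b < n → ¬ Joins a b (n , u)
  ¬Joins-out-of-n a<n b<n (inj₁ (n≡a , _)) = fresh a<n (sym n≡a)
  ¬Joins-out-of-n a<n b<n (inj₂ (n≡b , _)) = fresh b<n (sym n≡b)

  multiplicity-E : ∀ s t → multiplicity E s t ≡ indicator (endpointsAre s t (x , y)) + multiplicity R s t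
  multiplicity-E s t = trans (multiplicity-removeAt E i s t)
                             (cong (λ e → indicator (endpointsAre s t e) + multiplicity R s t) eᵢ≡xy)

  multiplicity-old : ∀ s t → s < n → t < n → multiplicity E′ s t ≡ multiplicity R s t
  multiplicity-old s t s<n t<n
    rewrite endpointsAre-false (¬Joins-into-n {u = x} s<n t<n)
          | endpointsAre-false (¬Joins-out-of-n {u = y} s<n t<n) = refl

  multiplicity-new : ∀ t → multiplicity E′ n t ≡ indicator (endpointsAre n t (x , n)) + indicator (endpointsAre n t (n , y))
  multiplicity-new t =
    trans (cong (indicator (endpointsAre n t (x , n)) +_)
                (cong (indicator (endpointsAre n t (n , y)) +_)
                      (multiplicity-zero R n t λ { {_ , _} m → ¬Joins-old-edge (proj₁ (R-old m)) (proj₂ (R-old m)) })))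
          (cong (indicator (endpointsAre n t (x , n)) +_) (+-identityʳ _))

  -- Subdividing: a walk of E becomes a walk of E′ once its xy-steps are
  -- replaced by x – n – y (possible whenever xy may be used at all).
  subdivide-walk : ∀ {X X′ a b a′ b′} → (∀ v → X v ≡ false → X′ v ≡ false) →
    (∀ {e} → e ∈ R → ¬ Joins a b e → ¬ Joins a′ b′ e) →
    (X x ≡ false → X y ≡ false → ¬ Joins a b (x , y) →
       X′ n ≡ false × ¬ Joins a′ b′ (x , n) × ¬ Joins a′ b′ (n , y)) →
    ∀ {u w} → Walk E X a b u w → Walk E′ X′ a′ b′ u w
  subdivide-walk {X} {X′} {a} {b} {a′} {b′} free⇒free keepR viaN p =
    walk-map (λ v → v) image (free⇒free _ (end-free p)) p
    where
      image : ∀ {u v} → (u , v) ∈ E → X u ≡ false → X v ≡ false → ¬ Joins a b (u , v) → Walk E′ X′ a′ b′ u v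
      image {u} {v} m Xu Xv ¬j with ∈-removeAt-split E i m
      ... | inj₁ m′ = edge (free⇒free u Xu) (free⇒free v Xv) (inj₁ (there (there m′)) , keepR m′ ¬j)
      ... | inj₂ uv≡eᵢ with trans uv≡eᵢ eᵢ≡xy
      ... | refl with viaN Xu Xv ¬j
      ... | X′n , ¬j₁ , ¬j₂ =
        cons (free⇒free x Xu) (inj₁ (here refl) , ¬j₁) (edge X′n (free⇒free y Xv) (inj₁ (there (here refl)) , ¬j₂))

  delete-n-walk : ∀ {X a b} → X n ≡ true → ∀ {u w} → Walk E′ X a b u w → Walk E X a b u w
  delete-n-walk {X} {a} {b} Xn p = walk-map (λ v → v) image (end-free p) p
    where
      n-used : X n ≡ false → ∀ {u v} → Walk E X a b u v
      n-used Xn′ = contradiction (trans (sym Xn) Xn′) λ ()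
      image : ∀ {u v} → (u , v) ∈ E′ → X u ≡ false → X v ≡ false → ¬ Joins a b (u , v) → Walk E X a b u v
      image (here refl)         Xu Xv ¬j = n-used Xv
      image (there (here refl)) Xu Xv ¬j = n-used Xu
      image (there (there m))   Xu Xv ¬j = edge Xu Xv (inj₁ (∈-removeAt⁻ E i m) , ¬j)

  -- Contracting: if xy is not an ab-edge, sending n to a "hub" c joined to x and
  -- to y maps walks of E′ between old vertices to walks of E.
  contract-walk-via : ∀ {X a b} c → (X x ≡ false → Walk E X a b x c) → (X y ≡ false → Walk E X a b c y) →
                      ∀ {u w} → u < n → w < n → Walk E′ X a b u w → Walk E X a b u w
  contract-walk-via {X} {a} {b} c x⇝c c⇝y {u} {w} u<n w<n p =
    subst₂ (Walk E X a b) (π-old u<n) (π-old w<n)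
      (walk-map π image (subst (λ v → X v ≡ false) (sym (π-old w<n)) (end-free p)) p)
    where
      π : ℕ → ℕ
      π v = if v ≡ᵇ n then c else v
      π-old : ∀ {v} → v < n → π v ≡ v
      π-old {v} v<n rewrite ≢⇒≡ᵇ-false (fresh v<n) = refl
      π-n : π n ≡ c
      π-n rewrite ≡ᵇ-refl n = refl
      image : ∀ {u v} → (u , v) ∈ E′ → X u ≡ false → X v ≡ false → ¬ Joins a b (u , v) → Walk E X a b (π u) (π v)
      image (here refl)         Xx _  _  = subst₂ (Walk E X a b) (sym (π-old x<n)) (sym π-n) (x⇝c Xx)
      image (there (here refl)) _  Xy _  = subst₂ (Walk E X a b) (sym π-n) (sym (π-old y<n)) (c⇝y Xy)
      image (there (there m))   Xu Xv ¬j =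
        subst₂ (Walk E X a b) (sym (π-old (proj₁ (R-old m)))) (sym (π-old (proj₂ (R-old m))))
               (edge Xu Xv (inj₁ (∈-removeAt⁻ E i m) , ¬j))

  contract-walk : ∀ {X a b} → ¬ Joins a b (x , y) → ∀ {u w} → u < n → w < n → Walk E′ X a b u w → Walk E X a b u w
  contract-walk {X} ¬jxy with X x in Xx
  ... | false = contract-walk-via x nil (λ Xy → edge Xx Xy (inj₁ xy∈E , ¬jxy))
  ... | true  = contract-walk-via y (λ Xx′ → contradiction (trans (sym Xx) Xx′) λ ()) nil

  through-n : ∀ {X a b} → a < n → b < n → X x ≡ false → X n ≡ false → X y ≡ false → Walk E′ X a b x y
  through-n a<n b<n Xx Xn Xy =
    cons Xx (inj₁ (here refl) , ¬Joins-into-n a<n b<n) (edge Xn Xy (inj₁ (there (here refl)) , ¬Joins-out-of-n a<n b<n))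

  multiplicity-E-E′ : ∀ s t → s < n → t < n →
                      multiplicity E s t ≡ indicator (endpointsAre s t (x , y)) + multiplicity E′ s t
  multiplicity-E-E′ s t s<n t<n =
    trans (multiplicity-E s t) (cong (indicator (endpointsAre s t (x , y)) +_) (sym (multiplicity-old s t s<n t<n)))

  -- Old pairs with xy among their st-edges: a cut of E′ must contain n
  -- (else s – n – t survives), and n plays the role of the deleted edge xy.
  cut-through-xy : ∀ {s t k} → s < n → t < n → Joins s t (x , y) → MinCut n E s t k → MinCut (suc n) E′ s t k
  cut-through-xy {s} {t} {k} s<n t<n j ((X , (Xs , Xt , noWalk) , cost≡k) , minimal) =
    (X⁺ , (trans (X⁺-old s s<n) Xs , trans (X⁺-old t t<n) Xt , noWalk ∘ restrict ∘ delete-n-walk X⁺n) ,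
          trans (cost-with-n X⁺ X⁺n) (trans (cong (_+ multiplicity E s t) (count-ext n X⁺ X X⁺-old)) cost≡k)) ,
    λ Y (Ys , Yt , noWalk′) →
      subst (k ≤_) (sym (cost-with-n Y (n-in-cut Y Ys Yt noWalk′)))
            (minimal Y (Ys , Yt , noWalk′ ∘ subdivide-walk (λ _ Yv → Yv) (λ _ ¬j → ¬j) (λ _ _ ¬j → contradiction j ¬j)))
    where
      X⁺ : VSet
      X⁺ = insert n X
      X⁺-old : ∀ v → v < n → X⁺ v ≡ X v
      X⁺-old v v<n rewrite ≢⇒≡ᵇ-false (fresh v<n) = refl
      X⁺n : X⁺ n ≡ true
      X⁺n rewrite ≡ᵇ-refl n = refl
      restrict : Walk E X⁺ s t s t → Walk E X s t s t
      restrict = walk-restrict inRange s<n (λ v v<n X⁺v → trans (sym (X⁺-old v v<n)) X⁺v)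
      n-in-cut : ∀ Y → Y s ≡ false → Y t ≡ false → ¬ Walk E′ Y s t s t → Y n ≡ true
      n-in-cut Y Ys Yt noWalk′ = ¬-not λ Yn → noWalk′ (s⇝t Yn j)
        where
          s⇝t : Y n ≡ false → Joins s t (x , y) → Walk E′ Y s t s t
          s⇝t Yn (inj₁ (refl , refl)) = through-n s<n t<n Ys Yn Yt
          s⇝t Yn (inj₂ (refl , refl)) = reverse (through-n s<n t<n Yt Yn Ys)
      cost-with-n : ∀ Y → Y n ≡ true → cost (suc n) E′ Y s t ≡ cost n E Y s t
      cost-with-n Y Yn = begin
        count (suc n) Y + multiplicity E′ s t
          ≡⟨ cong (_+ multiplicity E′ s t) (count-suc n Y) ⟩
        count n Y + indicator (Y n) + multiplicity E′ s t
          ≡⟨ cong (λ b → count n Y + indicator b + multiplicity E′ s t) Yn ⟩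
        count n Y + 1 + multiplicity E′ s t
          ≡⟨ +-assoc (count n Y) 1 (multiplicity E′ s t) ⟩
        count n Y + (1 + multiplicity E′ s t)
          ≡⟨ cong (λ b → count n Y + (indicator b + multiplicity E′ s t)) (endpointsAre-true j) ⟨
        count n Y + (indicator (endpointsAre s t (x , y)) + multiplicity E′ s t)
          ≡⟨ cong (count n Y +_) (multiplicity-E-E′ s t s<n t<n) ⟨
        count n Y + multiplicity E s t
          ∎
        where open ≡-Reasoning

  outside-st : ∀ {s t} → ¬ Joins s t (x , y) → ∃ λ z → (z ≡ x ⊎ z ≡ y) × z ≢ s × z ≢ t
  outside-st {s} {t} ¬j with x ≟ s | x ≟ t
  ... | no x≢s    | no x≢t    = x , inj₁ refl , x≢s , x≢t
  ... | yes refl  | _         = y , inj₂ refl , x≢y ∘ sym , λ y≡t → ¬j (inj₁ (refl , y≡t))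
  ... | no _      | yes refl  = y , inj₂ refl , (λ y≡s → ¬j (inj₂ (refl , y≡s))) , x≢y ∘ sym

  -- Old pairs without xy among their st-edges: contracting n turns a cut of E
  -- into one of E′; conversely a cut of E′ containing n trades n for a vertex
  -- z of xy outside {s,t}, which blocks every walk through xy.
  cut-avoiding-xy : ∀ {s t k} → s < n → t < n → ¬ Joins s t (x , y) → MinCut n E s t k → MinCut (suc n) E′ s t k
  cut-avoiding-xy {s} {t} {k} s<n t<n ¬j ((X , (Xs , Xt , noWalk) , cost≡k) , minimal) =
    (X⁻ , (trans (X⁻-old s s<n) Xs , trans (X⁻-old t t<n) Xt , noWalk ∘ restrict ∘ contract-walk ¬j s<n t<n) ,
          trans (cost-without-n X⁻ X⁻n) (trans (cong (_+ multiplicity E s t) (count-ext n X⁻ X X⁻-old)) cost≡k)) ,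
    lower
    where
      X⁻ : VSet
      X⁻ = delete n X
      X⁻-old : ∀ v → v < n → X⁻ v ≡ X v
      X⁻-old v v<n rewrite ≢⇒≡ᵇ-false (fresh v<n) = refl
      X⁻n : X⁻ n ≡ false
      X⁻n rewrite ≡ᵇ-refl n = refl
      restrict : Walk E X⁻ s t s t → Walk E X s t s t
      restrict = walk-restrict inRange s<n (λ v v<n X⁻v → trans (sym (X⁻-old v v<n)) X⁻v)
      mult-same : multiplicity E s t ≡ multiplicity E′ s t
      mult-same = trans (multiplicity-E-E′ s t s<n t<n)
                        (cong (λ b → indicator b + multiplicity E′ s t) (endpointsAre-false ¬j))
      cost-E′ : ∀ Y → cost (suc n) E′ Y s t ≡ count n Y + indicator (Y n) + multiplicity E s t
      cost-E′ Y = cong₂ _+_ (count-suc n Y) (sym mult-same)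
      cost-without-n : ∀ Y → Y n ≡ false → cost (suc n) E′ Y s t ≡ cost n E Y s t
      cost-without-n Y Yn = begin
        cost (suc n) E′ Y s t
          ≡⟨ cost-E′ Y ⟩
        count n Y + indicator (Y n) + multiplicity E s t
          ≡⟨ cong (λ b → count n Y + indicator b + multiplicity E s t) Yn ⟩
        count n Y + 0 + multiplicity E s t
          ≡⟨ cong (_+ multiplicity E s t) (+-identityʳ (count n Y)) ⟩
        cost n E Y s t
          ∎
        where open ≡-Reasoning
      lower : ∀ Y → Cut E′ Y s t → k ≤ cost (suc n) E′ Y s t
      lower Y (Ys , Yt , noWalk′) with Y n in Yn
      ... | false = subst (k ≤_) (sym (cost-without-n Y Yn))
                      (minimal Y (Ys , Yt , noWalk′ ∘ subdivide-walk (λ _ Yv → Yv) (λ _ ¬j′ → ¬j′)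
                                                  (λ _ _ _ → Yn , ¬Joins-into-n s<n t<n , ¬Joins-out-of-n s<n t<n)))
      ... | true with outside-st ¬j
      ... | z , z∈xy , z≢s , z≢t =
        subst (k ≤_) (sym (trans (cost-E′ Y) (cong (λ b → count n Y + indicator b + multiplicity E s t) Yn)))
              (≤-trans (minimal Y⁺ (trans (Y⁺-elsewhere s (z≢s ∘ sym)) Ys ,
                                    trans (Y⁺-elsewhere t (z≢t ∘ sym)) Yt , noWalk′ ∘ lift))
                       (+-monoˡ-≤ (multiplicity E s t) (count-update-≤ n Y Y⁺ z Y⁺-elsewhere)))
        where
          Y⁺ : VSet
          Y⁺ = insert z Y
          Y⁺-elsewhere : ∀ v → v ≢ z → Y⁺ v ≡ Y v
          Y⁺-elsewhere v v≢z = cong (_∨ Y v) (≢⇒≡ᵇ-false v≢z)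
          Y⁺z : Y⁺ z ≡ true
          Y⁺z = cong (_∨ Y z) (≡ᵇ-refl z)
          blocked : ∀ {w} → w ≡ x ⊎ w ≡ y → Y⁺ x ≡ false → Y⁺ y ≡ false → Y⁺ w ≡ false
          blocked (inj₁ refl) Y⁺x Y⁺y = Y⁺x
          blocked (inj₂ refl) Y⁺x Y⁺y = Y⁺y
          lift : Walk E Y⁺ s t s t → Walk E′ Y s t s t
          lift = subdivide-walk (λ v → ∨-conicalʳ (v ≡ᵇ z) (Y v)) (λ _ ¬j′ → ¬j′)
                                (λ Y⁺x Y⁺y _ → contradiction (trans (sym Y⁺z) (blocked z∈xy Y⁺x Y⁺y)) λ ())

  neighbour<n : ∀ {q} → q ≡ x ⊎ q ≡ y → q < n
  neighbour<n (inj₁ refl) = x<n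
  neighbour<n (inj₂ refl) = y<n

  ¬Joins-n-q : ∀ {q t} → q ≢ t → t < n → ¬ Joins n t (n , q)
  ¬Joins-n-q q≢t t<n (inj₁ (_ , q≡t)) = q≢t q≡t
  ¬Joins-n-q q≢t t<n (inj₂ (n≡t , _)) = fresh t<n (sym n≡t)

  step-to-neighbour : ∀ {q t} → q ≡ x ⊎ q ≡ y → q ≢ t → t < n → Step E′ n t n q
  step-to-neighbour (inj₁ refl) q≢t t<n = inj₂ (here refl) , ¬Joins-n-q q≢t t<n
  step-to-neighbour (inj₂ refl) q≢t t<n = inj₁ (there (here refl)) , ¬Joins-n-q q≢t t<n

  halves-avoid-nt : ∀ {q t} → q ≡ x ⊎ q ≡ y → q ≢ t → t < n → ¬ Joins q t (x , y) →
                    ¬ Joins n t (x , n) × ¬ Joins n t (n , y)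
  halves-avoid-nt q∈xy q≢t t<n ¬jxy = ¬jxn q∈xy , ¬jny q∈xy
    where
      ¬jxn : _ ≡ x ⊎ _ ≡ y → ¬ Joins n _ (x , n)
      ¬jxn _           (inj₁ (x≡n , _)) = fresh x<n x≡n
      ¬jxn (inj₁ refl) (inj₂ (x≡t , _)) = q≢t x≡t
      ¬jxn (inj₂ refl) (inj₂ (x≡t , _)) = ¬jxy (inj₂ (x≡t , refl))
      ¬jny : _ ≡ x ⊎ _ ≡ y → ¬ Joins n _ (n , y)
      ¬jny _           (inj₂ (n≡t , _)) = fresh t<n (sym n≡t)
      ¬jny (inj₁ refl) (inj₁ (_ , y≡t)) = ¬jxy (inj₁ (refl , y≡t))
      ¬jny (inj₂ refl) (inj₁ (_ , y≡t)) = q≢t y≡t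

  -- A neighbour q ≠ t of n that survives a cut Y of (n,t) sees Y as a cut of
  -- (q,t) in E; moreover xy is the only possible qt-edge of E, since any other
  -- would give the walk n – q – t.  As old cuts cost ≥ 2, Y is large.
  neighbour-bound : CutsAtLeast2 n E → ∀ {q t Y} → q ≡ x ⊎ q ≡ y → t < n → q ≢ t → Y q ≡ false →
                    Cut E′ Y n t → 2 ≤ count n Y + indicator (endpointsAre q t (x , y))
  neighbour-bound atLeast2 {q} {t} {Y} q∈xy t<n q≢t Yq (Yn , Yt , noWalk) =
    subst (2 ≤_) cost≡ (atLeast2 q t q<n t<n q≢t Y (Yq , Yt , noWalk ∘ cons Yn n→q ∘ lift))
    where
      q<n : q < n
      q<n = neighbour<n q∈xy
      n→q : Step E′ n t n q
      n→q = step-to-neighbour q∈xy q≢t t<n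
      lift : Walk E Y q t q t → Walk E′ Y n t q t
      lift = subdivide-walk (λ _ Yv → Yv) (λ { {_ , _} m _ → ¬Joins-old-edge (proj₁ (R-old m)) (proj₂ (R-old m)) })
                            (λ _ _ ¬jxy → Yn , halves-avoid-nt q∈xy q≢t t<n ¬jxy)
      direct : ∀ {u v} → (u , v) ∈ R → Joins q t (u , v) → Walk E′ Y n t q t
      direct m (inj₁ (refl , refl)) = edge Yq Yt (inj₁ (there (there m)) , ¬Joins-old-edge q<n t<n)
      direct m (inj₂ (refl , refl)) = edge Yq Yt (inj₂ (there (there m)) , ¬Joins-old-edge q<n t<n)
      no-other-edge : multiplicity R q t ≡ 0
      no-other-edge = multiplicity-zero R q t λ { {_ , _} m j → noWalk (cons Yn n→q (direct m j)) }
      cost≡ : cost n E Y q t ≡ count n Y + indicator (endpointsAre q t (x , y))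
      cost≡ = cong (count n Y +_) (trans (multiplicity-E q t)
                                         (trans (cong (indicator (endpointsAre q t (x , y)) +_) no-other-edge)
                                                (+-identityʳ _)))

  CoversNeighbours : VSet → ℕ → Set
  CoversNeighbours Y t = ∀ {v} → v ≡ x ⊎ v ≡ y → v ≢ t → Y v ≡ true

  cannot-leave : ∀ {Y t v} → CoversNeighbours Y t → v ≡ x ⊎ v ≡ y → ¬ Joins n t (n , v) → Y v ≡ false → ⊥
  cannot-leave {t = t} {v} cover v∈xy ¬j Yv with v ≟ t
  ... | yes v≡t = ¬j (inj₁ (refl , v≡t))
  ... | no  v≢t = contradiction (trans (sym Yv) (cover v∈xy v≢t)) λ ()

  isolated : ∀ {Y t u w} → CoversNeighbours Y t → u ≡ n → Walk E′ Y n t u w → w ≡ n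
  isolated cover u≡n (nil _)                                    = u≡n
  isolated cover u≡n (cons _ (inj₁ (here refl) , _) _)          = contradiction u≡n (fresh x<n)
  isolated cover _   (cons _ (inj₁ (there (here refl)) , ¬j) p) = ⊥-elim (cannot-leave cover (inj₂ refl) ¬j (start-free p))
  isolated cover u≡n (cons _ (inj₁ (there (there m)) , _) _)    = contradiction u≡n (fresh (proj₁ (R-old m)))
  isolated cover _   (cons _ (inj₂ (here refl) , ¬j) p)         = ⊥-elim (cannot-leave cover (inj₁ refl) ¬j (start-free p))
  isolated cover u≡n (cons _ (inj₂ (there (here refl)) , _) _)  = contradiction u≡n (fresh y<n)
  isolated cover u≡n (cons _ (inj₂ (there (there m)) , _) _)    = contradiction u≡n (fresh (proj₂ (R-old m)))

  neighbours-cut : ∀ {t} X → t < n → CoversNeighbours X t → X n ≡ false → X t ≡ false → Cut E′ X n t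
  neighbours-cut X t<n cover Xn Xt = Xn , Xt , λ w → fresh t<n (isolated cover refl w)

  multiplicity-n-x : multiplicity E′ n x ≡ 1
  multiplicity-n-x
    rewrite multiplicity-new x | endpointsAre-true {n} {x} {x , n} (inj₂ (refl , refl))
          | endpointsAre-false {n} {x} {n , y} (¬Joins-n-q (x≢y ∘ sym) x<n) = refl

  multiplicity-n-y : multiplicity E′ n y ≡ 1
  multiplicity-n-y
    rewrite multiplicity-new y | endpointsAre-true {n} {y} {n , y} (inj₁ (refl , refl))
          | endpointsAre-false {n} {y} {x , n} λ { (inj₁ (x≡n , _)) → fresh x<n x≡n ; (inj₂ (x≡y , _)) → x≢y x≡y } = refl

  multiplicity-n-other : ∀ {t} → t < n → t ≢ x → t ≢ y → multiplicity E′ n t ≡ 0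
  multiplicity-n-other {t} t<n t≢x t≢y
    rewrite multiplicity-new t | endpointsAre-false {n} {t} {n , y} (¬Joins-n-q (t≢y ∘ sym) t<n)
          | endpointsAre-false {n} {t} {x , n} λ { (inj₁ (x≡n , _)) → fresh x<n x≡n ; (inj₂ (x≡t , _)) → t≢x (sym x≡t) } = refl

  nonempty : CutsAtLeast2 n E → ∀ {q t Y} → q ≡ x ⊎ q ≡ y → t < n → q ≢ t → Joins q t (x , y) →
             Cut E′ Y n t → 1 ≤ count (suc n) Y
  nonempty atLeast2 {q} {t} {Y} q∈xy t<n q≢t j cut with Y q in Yq
  ... | true  = count-≥-singleton (suc n) Y q (m<n⇒m<1+n (neighbour<n q∈xy)) Yq
  ... | false = ≤-trans (+-cancelʳ-≤ 1 1 (count n Y) bound) (count-≤-suc n Y)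
    where
      bound : 2 ≤ count n Y + 1
      bound = subst (λ b → 2 ≤ count n Y + indicator b) (endpointsAre-true j)
                    (neighbour-bound atLeast2 q∈xy t<n q≢t Yq cut)

  two-from-neighbour : CutsAtLeast2 n E → ∀ {q t Y} → q ≡ x ⊎ q ≡ y → t < n → q ≢ t → Y q ≡ false →
                       ¬ Joins q t (x , y) → Cut E′ Y n t → 2 ≤ count (suc n) Y
  two-from-neighbour atLeast2 {q} {t} {Y} q∈xy t<n q≢t Yq ¬j cut =
    ≤-trans (subst (2 ≤_) (trans (cong (λ b → count n Y + indicator b) (endpointsAre-false ¬j)) (+-identityʳ _))
                   (neighbour-bound atLeast2 q∈xy t<n q≢t Yq cut))
            (count-≤-suc n Y)

  at-least-two : CutsAtLeast2 n E → ∀ {t Y} → t < n → t ≢ x → t ≢ y → Cut E′ Y n t → 2 ≤ count (suc n) Y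
  at-least-two atLeast2 {t} {Y} t<n t≢x t≢y cut with Y x in Yx | Y y in Yy
  ... | false | _     = two-from-neighbour atLeast2 (inj₁ refl) t<n (t≢x ∘ sym) Yx
                          (λ { (inj₁ (_ , y≡t)) → t≢y (sym y≡t) ; (inj₂ (x≡t , _)) → t≢x (sym x≡t) }) cut
  ... | true  | false = two-from-neighbour atLeast2 (inj₂ refl) t<n (t≢y ∘ sym) Yy
                          (λ { (inj₁ (x≡y , _)) → x≢y x≡y ; (inj₂ (x≡t , _)) → t≢x (sym x≡t) }) cut
  ... | true  | true  = count-≥-pair (suc n) Y x y (m<n⇒m<1+n x<n) (m<n⇒m<1+n y<n) x≢y Yx Yy

  -- For an old vertex t, the neighbours of n other than t form a minimum
  -- cut of (n,t), and every cut costs 2.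
  new-pair : CutsAtLeast2 n E → ∀ t → t < n → MinCut (suc n) E′ n t 2
  new-pair atLeast2 t t<n with t ≟ x | t ≟ y
  ... | yes refl | _ =
    (⁅ y ⁆ᵛ , neighbours-cut ⁅ y ⁆ᵛ x<n cover (≢⇒≡ᵇ-false (fresh y<n ∘ sym)) (≢⇒≡ᵇ-false x≢y) ,
              cong₂ _+_ (count-singleton (suc n) y (m<n⇒m<1+n y<n)) multiplicity-n-x) ,
    λ Y cut → subst (2 ≤_) (cong (count (suc n) Y +_) (sym multiplicity-n-x))
                    (+-monoˡ-≤ 1 (nonempty atLeast2 (inj₂ refl) x<n (x≢y ∘ sym) (inj₂ (refl , refl)) cut))
    where
      cover : CoversNeighbours ⁅ y ⁆ᵛ x
      cover (inj₁ refl) x≢x = contradiction refl x≢x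
      cover (inj₂ refl) _   = ≡ᵇ-refl y
  ... | no _ | yes refl =
    (⁅ x ⁆ᵛ , neighbours-cut ⁅ x ⁆ᵛ y<n cover (≢⇒≡ᵇ-false (fresh x<n ∘ sym)) (≢⇒≡ᵇ-false (x≢y ∘ sym)) ,
              cong₂ _+_ (count-singleton (suc n) x (m<n⇒m<1+n x<n)) multiplicity-n-y) ,
    λ Y cut → subst (2 ≤_) (cong (count (suc n) Y +_) (sym multiplicity-n-y))
                    (+-monoˡ-≤ 1 (nonempty atLeast2 (inj₁ refl) y<n x≢y (inj₁ (refl , refl)) cut))
    where
      cover : CoversNeighbours ⁅ x ⁆ᵛ y
      cover (inj₁ refl) _   = ≡ᵇ-refl x
      cover (inj₂ refl) y≢y = contradiction refl y≢y
  ... | no t≢x | no t≢y =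
    (X , neighbours-cut X t<n cover Xn Xt ,
         cong₂ _+_ (count-pair (suc n) x y (m<n⇒m<1+n x<n) (m<n⇒m<1+n y<n) x≢y) (multiplicity-n-other t<n t≢x t≢y)) ,
    λ Y cut → subst (2 ≤_) (cong (count (suc n) Y +_) (sym (multiplicity-n-other t<n t≢x t≢y)))
                    (≤-trans (at-least-two atLeast2 t<n t≢x t≢y cut) (m≤m+n _ 0))
    where
      X : VSet
      X = insert y ⁅ x ⁆ᵛ
      cover : CoversNeighbours X t
      cover (inj₁ refl) _ rewrite ≡ᵇ-refl x = ∨-zeroʳ (x ≡ᵇ y)
      cover (inj₂ refl) _ rewrite ≡ᵇ-refl y = refl
      Xn : X n ≡ false
      Xn rewrite ≢⇒≡ᵇ-false (fresh x<n ∘ sym) | ≢⇒≡ᵇ-false (fresh y<n ∘ sym) = refl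
      Xt : X t ≡ false
      Xt rewrite ≢⇒≡ᵇ-false t≢x | ≢⇒≡ᵇ-false t≢y = refl

  old-pair : ∀ {s t k} → s < n → t < n → MinCut n E s t k → MinCut (suc n) E′ s t k
  old-pair {s} {t} s<n t<n with joins? s t (x , y)
  ... | yes j = cut-through-xy s<n t<n j
  ... | no ¬j = cut-avoiding-xy s<n t<n ¬j

  -- n occurs in no logged edge, so κ(n,t) = 0 + 2.
  κ-new : ∀ log → LogIn n log → 2 ≤ n → ∀ t → κ (log ∷ʳ (S , (x , y))) n t ≡ 2
  κ-new log logIn 2≤n t =
    trans (cong (_+ offset n t) (trans (ε-snoc-S log (x , y) n t) (ε-unused log n t unused))) (offset-far t 2≤n)
    where
      unused : ∀ {o e} → (o , e) ∈ log → ¬ Joins n t e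
      unused {e = _ , _} m = ¬Joins-old-edge (proj₁ (logIn m)) (proj₂ (logIn m))

  subdivision-step : ∀ log → Connectivity (mg n E) log → BaseDoubled log → LogIn n log → 2 ≤ n →
                     Connectivity (mg (suc n) E′) (log ∷ʳ (S , (x , y)))
  subdivision-step log conn doubled logIn 2≤n s t s<1+n t<1+n s≢t
    with m≤n⇒m<n∨m≡n (≤-pred s<1+n) | m≤n⇒m<n∨m≡n (≤-pred t<1+n)
  ... | inj₁ s<n  | inj₁ t<n  = subst (MinCut (suc n) E′ s t) (sym (κ-old s t))
                                      (old-pair s<n t<n (conn s t s<n t<n s≢t))
    where
      κ-old : ∀ s t → κ (log ∷ʳ (S , (x , y))) s t ≡ κ log s t
      κ-old s t = cong (_+ offset s t) (ε-snoc-S log (x , y) s t)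
  ... | inj₂ refl | inj₁ t<n  = subst (MinCut (suc n) E′ n t) (sym (κ-new log logIn 2≤n t))
                                      (new-pair (cuts-at-least-2 {mg n E} {log} conn doubled) t t<n)
  ... | inj₁ s<n  | inj₂ refl =
    subst (MinCut (suc n) E′ s n) (sym (trans (κ-sym (log ∷ʳ (S , (x , y))) s n) (κ-new log logIn 2≤n s)))
          (MinCut-sym {N = suc n} (new-pair (cuts-at-least-2 {mg n E} {log} conn doubled) s s<n))
  ... | inj₂ refl | inj₂ refl = contradiction refl s≢t

  E′-in-range : EdgesIn (suc n) E′
  E′-in-range (here refl)         = m<n⇒m<1+n x<n , n<1+n n , fresh x<n
  E′-in-range (there (here refl)) = n<1+n n , m<n⇒m<1+n y<n , fresh y<n ∘ sym
  E′-in-range (there (there m))   =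
    let u<n , v<n , u≢v = inRange (∈-removeAt⁻ E i m) in m<n⇒m<1+n u<n , m<n⇒m<1+n v<n , u≢v

apply-S : ∀ n E i → apply S (mg n E) i ≡ mg (suc n) ((proj₁ (lookup E i) , n) ∷ (n , proj₂ (lookup E i)) ∷ removeAt E i)
apply-S n E i with lookup E i
... | (x , y) = refl

WellFormed : MG → List (Op × (ℕ × ℕ)) → Set
WellFormed G log = 2 ≤ nv G × EdgesIn (nv G) (edges G) × LogIn (nv G) log

LogIn-snoc : ∀ {N E log} → EdgesIn N E → LogIn N log → ∀ o i → LogIn N (log ∷ʳ (o , lookup E i))
LogIn-snoc {E = E} {log} inRange logIn o i m with ∈-++⁻ log m
... | inj₁ m′          = logIn m′
... | inj₂ (here refl) = let u<N , v<N , _ = inRange (∈-lookup {xs = E} i) in u<N , v<N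

LogIn-suc : ∀ {N log} → LogIn N log → LogIn (suc N) log
LogIn-suc logIn m = let u<N , v<N = logIn m in m<n⇒m<1+n u<N , m<n⇒m<1+n v<N

well-formed : ∀ {G log} → ConstrSeq G log → WellFormed G log
well-formed start = ≤-refl , (λ { (here refl) → s≤s z≤n , s≤s (s≤s z≤n) , λ () }) , λ ()
well-formed (step {mg n E} seq P i) with well-formed seq
... | 2≤n , inRange , logIn = 2≤n , inRange′ , LogIn-snoc inRange logIn P i
  where
    inRange′ : EdgesIn n (lookup E i ∷ E)
    inRange′ (here refl) = inRange (∈-lookup i)
    inRange′ (there m)   = inRange m
well-formed (step {mg n E} seq S i) rewrite apply-S n E i with well-formed seq
... | 2≤n , inRange , logIn =
  m≤n⇒m≤1+n 2≤n , Subdivision.E′-in-range n E i _ _ refl inRange , LogIn-suc (LogIn-snoc inRange logIn S i)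

operation-step : ∀ {G log} o i → Connectivity G log → BaseDoubled log → WellFormed G log →
                 Connectivity (apply o G i) (log ∷ʳ (o , lookup (edges G) i))
operation-step {mg n E} {log} P i conn _ _ = parallel-step n E log i conn
operation-step {mg n E} {log} S i conn doubled (2≤n , inRange , logIn) rewrite apply-S n E i =
  Subdivision.subdivision-step n E i _ _ refl inRange log conn doubled logIn 2≤n

FirstIsP-init : ∀ (log : List (Op × (ℕ × ℕ))) a b → FirstIsP ((log ∷ʳ a) ∷ʳ b) → FirstIsP (log ∷ʳ a)
FirstIsP-init []      a b firstP = firstP
FirstIsP-init (_ ∷ _) a b firstP = firstP

∷ʳ-nonempty : ∀ {A : Set} (l : List A) a → l ∷ʳ a ≢ []
∷ʳ-nonempty []      a ()
∷ʳ-nonempty (_ ∷ _) a ()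

invariant : ∀ {G log} → ConstrSeq G log → FirstIsP log → log ≢ [] → Connectivity G log × BaseDoubled log
invariant start                           _      nonempty = contradiction refl nonempty
invariant (step start .P fzero)           refl   _        = connectivity-G₂ , s≤s z≤n
invariant (step {log = log} seq@(step {log = log′} _ _ _) o i) firstP _
  with invariant seq (FirstIsP-init log′ _ _ firstP) (∷ʳ-nonempty log′ _)
... | conn , doubled = operation-step o i conn doubled (well-formed seq) , ≤-trans doubled (ε-snoc-≤ log _ 0 1)

-- From the multigraph G_k to the simple graph G of Defs.

toVSet : ∀ {N} → Subset N → VSet
toVSet []       _       = false
toVSet (b ∷ bs) zero    = b
toVSet (b ∷ bs) (suc v) = toVSet bs v

toVSet-lookup : ∀ {N} (Xs : Subset N) v → toVSet Xs (toℕ v) ≡ Vec.lookup Xs v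
toVSet-lookup (b ∷ bs) fzero    = refl
toVSet-lookup (b ∷ bs) (fsuc v) = toVSet-lookup bs v

count-toVSet : ∀ {N} (Xs : Subset N) → count N (toVSet Xs) ≡ ∣ Xs ∣
count-toVSet []           = refl
count-toVSet (true ∷ bs)  = cong suc (count-toVSet bs)
count-toVSet (false ∷ bs) = count-toVSet bs

fromVSet : ∀ N → VSet → Subset N
fromVSet N X = Vec.tabulate (X ∘ toℕ)

∣fromVSet∣ : ∀ N X → ∣ fromVSet N X ∣ ≡ count N X
∣fromVSet∣ zero    X = refl
∣fromVSet∣ (suc N) X with X 0
... | true  = cong suc (∣fromVSet∣ N (X ∘ suc))
... | false = ∣fromVSet∣ N (X ∘ suc)

∉⇒false : ∀ {N} (Xs : Subset N) v → v ∉ Xs → Vec.lookup Xs v ≡ false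
∉⇒false Xs v v∉Xs = ¬-not (v∉Xs ∘ lookup⇒[]= v Xs)

false⇒∉ : ∀ {N} (Xs : Subset N) v → Vec.lookup Xs v ≡ false → v ∉ Xs
false⇒∉ Xs v Xs[v]≡false v∈Xs = contradiction (trans (sym ([]=⇒lookup v∈Xs)) Xs[v]≡false) λ ()

∉-toVSet : ∀ {N} (Xs : Subset N) v → v ∉ Xs → toVSet Xs (toℕ v) ≡ false
∉-toVSet Xs v v∉Xs = trans (toVSet-lookup Xs v) (∉⇒false Xs v v∉Xs)

toVSet-∉ : ∀ {N} (Xs : Subset N) v → toVSet Xs (toℕ v) ≡ false → v ∉ Xs
toVSet-∉ Xs v Xs[v]≡false = false⇒∉ Xs v (trans (sym (toVSet-lookup Xs v)) Xs[v]≡false)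

∉-fromVSet : ∀ N X v → v ∉ fromVSet N X → X (toℕ v) ≡ false
∉-fromVSet N X v v∉X = trans (sym (lookup∘tabulate (X ∘ toℕ) v)) (∉⇒false (fromVSet N X) v v∉X)

fromVSet-∉ : ∀ N X v → X (toℕ v) ≡ false → v ∉ fromVSet N X
fromVSet-∉ N X v X[v]≡false = false⇒∉ (fromVSet N X) v (trans (lookup∘tabulate (X ∘ toℕ) v) X[v]≡false)

-- For nonadjacent s and t, walks of G_k avoiding the st-edges are walks of
-- G, and separators of G are cuts of G_k of the same size.
module Separators (G : MG) (inRange : EdgesIn (nv G) (edges G)) (s t : V G) (¬adj : ¬ Adj G s t) where

  N : ℕ
  N = nv G

  ¬Joins-adjacent : ∀ {u v} → Adj G u v → ¬ Joins (toℕ s) (toℕ t) (toℕ u , toℕ v)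
  ¬Joins-adjacent adj (inj₁ (u≡s , v≡t)) rewrite toℕ-injective u≡s | toℕ-injective v≡t = ¬adj adj
  ¬Joins-adjacent adj (inj₂ (u≡t , v≡s)) rewrite toℕ-injective u≡t | toℕ-injective v≡s = ¬adj (Adj-sym adj)
    where
      Adj-sym : ∀ {u v} → Adj G u v → Adj G v u
      Adj-sym (inj₁ m) = inj₂ m
      Adj-sym (inj₂ m) = inj₁ m

  no-st-edge : multiplicity (edges G) (toℕ s) (toℕ t) ≡ 0
  no-st-edge = multiplicity-zero (edges G) (toℕ s) (toℕ t) λ where
    m (inj₁ (refl , refl)) → ¬adj (inj₁ m)
    m (inj₂ (refl , refl)) → ¬adj (inj₂ m)

  walk-of-reach : ∀ {Xs X} → (∀ v → v ∉ Xs → X (toℕ v) ≡ false) →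
                  ∀ {u w} → Reach G Xs u w → Walk (edges G) X (toℕ s) (toℕ t) (toℕ u) (toℕ w)
  walk-of-reach free (here {u} u∉Xs)          = nil (free u u∉Xs)
  walk-of-reach free (there {u} u∉Xs adj r)   = cons (free u u∉Xs) (adj , ¬Joins-adjacent adj) (walk-of-reach free r)

  reach-of-walk : ∀ {Xs X} → (∀ v → X (toℕ v) ≡ false → v ∉ Xs) →
                  ∀ {u′ w′} → Walk (edges G) X (toℕ s) (toℕ t) u′ w′ → ∀ u w → toℕ u ≡ u′ → toℕ w ≡ w′ → Reach G Xs u w
  reach-of-walk free (nil Xu) u w refl w≡u with toℕ-injective w≡u
  ... | refl = here (free u Xu)
  reach-of-walk free (cons {v = v′} Xu (m , _) p) u w refl w≡w′ =
    there (free u Xu) adj (reach-of-walk free p v w (toℕ-fromℕ< v′<N) w≡w′)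
    where
      neighbour<N : ∀ {a b} → ((a , b) ∈ edges G) ⊎ ((b , a) ∈ edges G) → b < N
      neighbour<N (inj₁ ab∈E) = proj₁ (proj₂ (inRange ab∈E))
      neighbour<N (inj₂ ba∈E) = proj₁ (inRange ba∈E)
      v′<N : v′ < N
      v′<N = neighbour<N m
      v : V G
      v = fromℕ< v′<N
      adj : Adj G u v
      adj = subst (λ v″ → ((toℕ u , v″) ∈ edges G) ⊎ ((v″ , toℕ u) ∈ edges G)) (sym (toℕ-fromℕ< v′<N)) m

  cost≡count : ∀ X → cost N (edges G) X (toℕ s) (toℕ t) ≡ count N X
  cost≡count X = trans (cong (count N X +_) no-st-edge) (+-identityʳ _)

  min-separator : ∀ {k} → MinCut N (edges G) (toℕ s) (toℕ t) k → MinSepSize G s t k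
  min-separator {k} ((X , (Xs , Xt , noWalk) , cost≡k) , minimal) =
    (fromVSet N X ,
     (fromVSet-∉ N X s Xs , fromVSet-∉ N X t Xt , noWalk ∘ walk-of-reach (∉-fromVSet N X)) ,
     trans (∣fromVSet∣ N X) (trans (sym (cost≡count X)) cost≡k)) ,
    λ Ys (s∉Ys , t∉Ys , ¬reach) →
      subst (k ≤_) (trans (cost≡count (toVSet Ys)) (count-toVSet Ys))
            (minimal (toVSet Ys) (∉-toVSet Ys s s∉Ys , ∉-toVSet Ys t t∉Ys ,
                                  λ w → ¬reach (reach-of-walk (toVSet-∉ Ys) w s t refl refl)))

Base : ℕ → ℕ → Set
Base s t = (s ≡ 0 × t ≡ 1) ⊎ (s ≡ 1 × t ≡ 0)

offset-base : ∀ {s t} → Base s t → offset s t ≡ 1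
offset-base (inj₁ (refl , refl)) = refl
offset-base (inj₂ (refl , refl)) = refl

offset-other : ∀ s t → ¬ Base s t → offset s t ≡ 2
offset-other zero          zero          _     = refl
offset-other zero          (suc zero)    ¬base = contradiction (inj₁ (refl , refl)) ¬base
offset-other zero          (suc (suc t)) _     = refl
offset-other (suc zero)    zero          ¬base = contradiction (inj₂ (refl , refl)) ¬base
offset-other (suc zero)    (suc t)       _     = refl
offset-other (suc (suc s)) t             _     = refl

-- A 2-connected graph has at least three vertices, so it is not G₁.
nontrivial : ∀ {G log} → ConstrSeq G log → 3 ≤ nv G → log ≢ []
nontrivial start          (s≤s (s≤s ()))
nontrivial (step {log = log} _ _ _) _ = ∷ʳ-nonempty log _

lemma6 : (G : MG) (log : List (Op × (ℕ × ℕ))) → ConstrSeq G log → FirstIsP log →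
    TwoConnected G → (s t : V G) → s ≢ t → ¬ Adj G s t →
    (((toℕ s ≡ 0 × toℕ t ≡ 1) ⊎ (toℕ s ≡ 1 × toℕ t ≡ 0)) →
    MinSepSize G s t (suc (ε log (toℕ s) (toℕ t)))) ×
    (¬ ((toℕ s ≡ 0 × toℕ t ≡ 1) ⊎ (toℕ s ≡ 1 × toℕ t ≡ 0)) →
    MinSepSize G s t (suc (suc (ε log (toℕ s) (toℕ t)))))
lemma6 G log seq firstP (3≤n , _) s t s≢t ¬adj =
  (λ base  → subst (MinSepSize G s t) (κ≡ (offset-base base)) separator) ,
  (λ ¬base → subst (MinSepSize G s t) (κ≡ (offset-other (toℕ s) (toℕ t) ¬base)) separator)
  where
    s′ t′ : ℕ
    s′ = toℕ s
    t′ = toℕ t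
    conn : Connectivity G log
    conn = proj₁ (invariant seq firstP (nontrivial seq 3≤n))
    separator : MinSepSize G s t (κ log s′ t′)
    separator = Separators.min-separator G (proj₁ (proj₂ (well-formed seq))) s t ¬adj
                  (conn s′ t′ (toℕ<n s) (toℕ<n t) (s≢t ∘ toℕ-injective))
    κ≡ : ∀ {c} → offset s′ t′ ≡ c → κ log s′ t′ ≡ c + ε log s′ t′
    κ≡ {c} eq = trans (cong (ε log s′ t′ +_) eq) (+-comm (ε log s′ t′) c)
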